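{- For every graph $H$ of diameter two and every connected graph $G$ of order $n\ge 2$, $\dim_l(G\odot H)=n\cdot\dim_l(H)$.
   Context: All graphs are finite and simple. For a connected graph $X$, $d_X(x,y)$ is the length of a shortest path between $x$ and $y$. A vertex $w$ distinguishes two vertices $x,y$ if $d_X(w,x)\ne d_X(w,y)$. A set $S\subseteq V(X)$ is a local metric generator for $X$ if every two adjacent vertices of $X$ are distinguished by some vertex of $S$; a local metric generator of minimum cardinality is a local metric basis, and its cardinality is the local metric dimension $\dim_l(X)$. For a graph $G$ of order $n$ with vertices $v_1,\dots,v_n$ and a graph $H$, the corona product $G\odot H$ is obtained from one copy of $G$ and $n$ disjoint copies $H_1,\dots,H_n$ of $H$ by joining $v_i$ by an edge to every vertex of $H_i$. -}

module Defs where

open import Data.Nat using (ℕ; zero; suc; _≤_; _*_; _+_)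
open import Data.Bool using (Bool; true; false; T; _∧_)
open import Data.Fin using (Fin; splitAt; remQuot; _≟_)
open import Data.Fin.Subset using (Subset; _∈_; ∣_∣)
open import Data.Sum using (_⊎_; inj₁; inj₂)
open import Data.Product using (Σ; ∃; ∃-syntax; _×_; _,_)
open import Relation.Binary.PropositionalEquality using (_≡_; _≢_)
open import Relation.Nullary.Decidable using (⌊_⌋)

Adj : ℕ → Set
Adj n = Fin n → Fin n → Bool

IsSimple : ∀ {n} → Adj n → Set
IsSimple A = (∀ x y → A x y ≡ A y x) × (∀ x → A x x ≡ false)

data Walk {n} (A : Adj n) : Fin n → Fin n → ℕ → Set where
  here : ∀ {x} → Walk A x x zero
  step : ∀ {x y z k} → T (A x y) → Walk A y z k → Walk A x z (suc k)

Dist : ∀ {n} → Adj n → Fin n → Fin n → ℕ → Set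
Dist A x y k = Walk A x y k × (∀ j → Walk A x y j → k ≤ j)

Connected : ∀ {n} → Adj n → Set
Connected A = ∀ x y → ∃[ k ] Walk A x y k

HasDiameter : ∀ {n} → Adj n → ℕ → Set
HasDiameter A d =
  Connected A
  × (∀ x y k → Dist A x y k → k ≤ d)
  × (∃[ x ] ∃[ y ] Dist A x y d)

Distinguishes : ∀ {n} → Adj n → Fin n → Fin n → Fin n → Set
Distinguishes A w x y = ∀ a b → Dist A w x a → Dist A w y b → a ≢ b

IsLocalMetricGenerator : ∀ {n} → Adj n → Subset n → Set
IsLocalMetricGenerator A S =
  ∀ x y → T (A x y) → ∃[ w ] (w ∈ S × Distinguishes A w x y)

LocalMetricDim : ∀ {n} → Adj n → ℕ → Set
LocalMetricDim {n} A k =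
  (∃[ S ] (IsLocalMetricGenerator A S × ∣ S ∣ ≡ k))
  × (∀ (S : Subset n) → IsLocalMetricGenerator A S → k ≤ ∣ S ∣)

-- Vertices Fin (n + n * m): the first n are the vertices v_i of G;
-- a vertex j of the second block, with remQuot m j = (i , h), is
-- vertex h of the copy H_i.
corona : ∀ {n m} → Adj n → Adj m → Adj (n + n * m)
corona {n} {m} G H u v with splitAt n u | splitAt n v
... | inj₁ i | inj₁ j = G i j
... | inj₁ i | inj₂ q with remQuot {n} m q
...   | (i' , _) = ⌊ i ≟ i' ⌋
corona {n} {m} G H u v | inj₂ p | inj₁ j with remQuot {n} m p
...   | (i' , _) = ⌊ i' ≟ j ⌋
corona {n} {m} G H u v | inj₂ p | inj₂ q with remQuot {n} m p | remQuot {n} m q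
...   | (i , h) | (i' , h') = ⌊ i ≟ i' ⌋ ∧ H h h'

-- Let v_i be the vertices of G and H_i the copies of H. A vertex outside H_i reaches H_i only
-- through v_i, so it is at the same distance from all vertices of H_i and distinguishes none of
-- the edges inside H_i. Since H has diameter two, the detour through v_i (of length 2) never
-- shortens a path inside H_i, so distances in H_i are those of H. Hence any local metric
-- generator of G ⊙ H meets every H_i in a local metric generator of H, giving n · dim_l(H) as a
-- lower bound. Conversely, a basis of H placed in every copy is a generator: edges inside H_i are
-- handled there, and an edge at v_i is distinguished by a basis vertex in H_i (if both ends are
-- base vertices) or in some other copy H_j (if one end lies in H_i); this needs n ≥ 2.

module Submission where

open import Defs
open import Data.Nat using (ℕ; zero; suc; _≤_; _<_; _*_; _+_; z≤n; s≤s)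
open import Data.Nat.Properties using (module ≤-Reasoning; ≤-trans; ≤-antisym; <⇒≱; +-mono-≤; +-comm; m≤n+m)
open import Data.Bool using (Bool; true; false; T; _∧_; if_then_else_)
open import Data.Bool.Properties using (T-∧)
open import Data.Fin as Fin using (Fin; splitAt; remQuot; combine; _↑ˡ_; _↑ʳ_)
open import Data.Fin.Properties
  using (any?; splitAt-↑ˡ; splitAt-↑ʳ; splitAt⁻¹-↑ˡ; splitAt⁻¹-↑ʳ; remQuot-combine; combine-remQuot;
         ↑ʳ-injective; combine-injective)
open import Data.Fin.Subset using (Subset; _∈_; ∣_∣)
open import Data.Vec using (lookup; tabulate)
open import Data.Vec.Properties using (lookup∘tabulate; tabulate∘lookup; []=⇒lookup; lookup⇒[]=)
open import Data.Sum using (inj₁; inj₂; [_,_]′)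
open import Data.Product using (∃; ∃-syntax; _×_; _,_; proj₁; proj₂)
open import Data.Empty using (⊥-elim)
open import Function using (_∘_; Equivalence)
open import Relation.Nullary using (Dec; yes; no; ¬_)
open import Relation.Nullary.Decidable using (⌊_⌋; toWitness; fromWitness; map′; T?; _×-dec_)
open import Relation.Binary.PropositionalEquality
  using (_≡_; _≢_; refl; sym; trans; cong; cong₂; subst; module ≡-Reasoning)

least-witness : ∀ {P : ℕ → Set} → (∀ j → Dec (P j)) → ∀ {k} → P k
              → ∃[ j ] (P j × (∀ i → P i → j ≤ i))
least-witness P? pk with P? 0
... | yes p0 = 0 , p0 , λ _ _ → z≤n
least-witness P? {zero}  pk | no ¬p0 = ⊥-elim (¬p0 pk)
least-witness {P} P? {suc k} pk | no ¬p0 with least-witness (P? ∘ suc) pk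
... | j , pj , j-least = suc j , pj , least
  where
    least : ∀ i → P i → suc j ≤ i
    least zero    p0 = ⊥-elim (¬p0 p0)
    least (suc i) pi = s≤s (j-least i pi)

module Walks {n} (A : Adj n) where

  walk-length-0 : ∀ {x y} → Walk A x y 0 → x ≡ y
  walk-length-0 here = refl

  walk-length-1 : ∀ {x y} → Walk A x y 1 → T (A x y)
  walk-length-1 (step e here) = e

  infixr 5 _++ʷ_
  _++ʷ_ : ∀ {x y z a b} → Walk A x y a → Walk A y z b → Walk A x z (a + b)
  here     ++ʷ w = w
  step e v ++ʷ w = step e (v ++ʷ w)

  walk? : ∀ x y k → Dec (Walk A x y k)
  walk? x y zero    = map′ (λ { refl → here }) walk-length-0 (x Fin.≟ y)
  walk? x y (suc k) = map′ (λ (_ , e , w) → step e w) (λ { (step e w) → _ , e , w })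
                           (any? λ z → T? (A x z) ×-dec walk? z y k)

  dist-exists : ∀ {x y k} → Walk A x y k → ∃ (Dist A x y)
  dist-exists = least-witness (walk? _ _)

  dist-unique : ∀ {x y a b} → Dist A x y a → Dist A x y b → a ≡ b
  dist-unique (wa , a-min) (wb , b-min) = ≤-antisym (a-min _ wb) (b-min _ wa)

  StrictlyCloser NoFarther : Fin n → Fin n → Fin n → Set
  StrictlyCloser w x y = ∀ {b} → Walk A w y b → ∃[ c ] (c < b × Walk A w x c)
  NoFarther      w x y = ∀ {b} → Walk A w y b → ∃[ c ] (c ≤ b × Walk A w x c)

  strictlyCloser⇒distinguishes : ∀ {w x y} → StrictlyCloser w x y → Distinguishes A w x y
  strictlyCloser⇒distinguishes closer a b (_ , a-min) (wb , _) refl with closer wb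
  ... | c , c<a , wc = <⇒≱ c<a (a-min c wc)

  distinguishes-sym : ∀ {w x y} → Distinguishes A w x y → Distinguishes A w y x
  distinguishes-sym d a b da db eq = d b a db da (sym eq)

  equidistant⇒¬distinguishes : ∀ {w x y k} → Walk A w x k
    → NoFarther w x y → NoFarther w y x → ¬ Distinguishes A w x y
  equidistant⇒¬distinguishes wx x≼y y≼x d with dist-exists wx
  ... | a , da@(wa , a-min) with y≼x wa
  ...   | c , c≤a , wc with dist-exists wc
  ...     | b , db@(wb , b-min) with x≼y wb
  ...       | c′ , c′≤b , wc′ =
    d a b da db (≤-antisym (≤-trans (a-min c′ wc′) c′≤b) (≤-trans (b-min c wc) c≤a))

  generator-nonempty : ∀ {S x y} → IsLocalMetricGenerator A S → T (A x y) → ∃[ w ] (w ∈ S)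
  generator-nonempty gen e with gen _ _ e
  ... | w , w∈S , _ = w , w∈S

count : ∀ {n} → (Fin n → Bool) → ℕ
count {zero}  f = 0
count {suc n} f = if f Fin.zero then suc (count (f ∘ Fin.suc)) else count (f ∘ Fin.suc)

∣tabulate∣≡count : ∀ {n} (f : Fin n → Bool) → ∣ tabulate f ∣ ≡ count f
∣tabulate∣≡count {zero}  f = refl
∣tabulate∣≡count {suc n} f with f Fin.zero
... | true  = cong suc (∣tabulate∣≡count (f ∘ Fin.suc))
... | false = ∣tabulate∣≡count (f ∘ Fin.suc)

∣p∣≡count-lookup : ∀ {n} (p : Subset n) → ∣ p ∣ ≡ count (lookup p)
∣p∣≡count-lookup p = trans (cong ∣_∣ (sym (tabulate∘lookup p))) (∣tabulate∣≡count (lookup p))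

count-cong : ∀ {n} {f g : Fin n → Bool} → (∀ x → f x ≡ g x) → count f ≡ count g
count-cong {zero}  eq = refl
count-cong {suc n} eq rewrite eq Fin.zero = cong (λ c → if _ then suc c else c) (count-cong (eq ∘ Fin.suc))

count-false : ∀ n → count {n} (λ _ → false) ≡ 0
count-false zero    = refl
count-false (suc n) = count-false n

count-↑ : ∀ a {b} (f : Fin (a + b) → Bool) → count f ≡ count (f ∘ (_↑ˡ b)) + count (f ∘ (a ↑ʳ_))
count-↑ zero    f = refl
count-↑ (suc a) f with f Fin.zero
... | true  = cong suc (count-↑ a (f ∘ Fin.suc))
... | false = count-↑ a (f ∘ Fin.suc)

count-blocks-≥ : ∀ n {m k} (f : Fin (n * m) → Bool) → (∀ i → k ≤ count (f ∘ combine {n} {m} i))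
               → n * k ≤ count f
count-blocks-≥ zero    f bound = z≤n
count-blocks-≥ (suc n) {m} f bound rewrite count-↑ m f =
  +-mono-≤ (bound Fin.zero) (count-blocks-≥ n (f ∘ (m ↑ʳ_)) (bound ∘ Fin.suc))

count-blocks-≡ : ∀ n {m k} (f : Fin (n * m) → Bool) → (∀ i → count (f ∘ combine {n} {m} i) ≡ k)
               → count f ≡ n * k
count-blocks-≡ zero    f each = refl
count-blocks-≡ (suc n) {m} f each rewrite count-↑ m f =
  cong₂ _+_ (each Fin.zero) (count-blocks-≡ n (f ∘ (m ↑ʳ_)) (each ∘ Fin.suc))

other-than : ∀ {n} → 2 ≤ n → (i : Fin n) → ∃[ j ] (j ≢ i)
other-than (s≤s (s≤s _)) Fin.zero    = Fin.suc Fin.zero , λ ()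
other-than (s≤s (s≤s _)) (Fin.suc i) = Fin.zero , λ ()

DiameterAtMost : ∀ {n} → Adj n → ℕ → Set
DiameterAtMost A d = ∀ x y k → Dist A x y k → k ≤ d

module Corona {n m} (G : Adj n) (H : Adj m) where

  E : Adj (n + n * m)
  E = corona G H

  base : Fin n → Fin (n + n * m)
  base i = i ↑ˡ (n * m)

  copy : Fin n → Fin m → Fin (n + n * m)
  copy i h = n ↑ʳ combine i h

  private
    split-base : ∀ i → splitAt n (base i) ≡ inj₁ i
    split-base i = splitAt-↑ˡ n i (n * m)

    split-copy : ∀ i h → splitAt n (copy i h) ≡ inj₂ (combine i h)
    split-copy i h = splitAt-↑ʳ n (n * m) (combine i h)

    quotient-combine : ∀ i h → proj₂ (Fin.quotRem {n} m (combine i h)) ≡ i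
    quotient-combine i h = cong proj₁ (remQuot-combine {n} {m} i h)

    remainder-combine : ∀ i h → proj₁ (Fin.quotRem {n} m (combine i h)) ≡ h
    remainder-combine i h = cong proj₂ (remQuot-combine {n} {m} i h)

  adj-base-base : ∀ i j → E (base i) (base j) ≡ G i j
  adj-base-base i j rewrite split-base i | split-base j = refl

  adj-base-copy : ∀ i j h → E (base i) (copy j h) ≡ ⌊ i Fin.≟ j ⌋
  adj-base-copy i j h rewrite split-base i | split-copy j h | quotient-combine j h = refl

  adj-copy-base : ∀ i j h → E (copy j h) (base i) ≡ ⌊ j Fin.≟ i ⌋
  adj-copy-base i j h rewrite split-base i | split-copy j h | quotient-combine j h = refl

  adj-copy-copy : ∀ i j h h′ → E (copy i h) (copy j h′) ≡ ⌊ i Fin.≟ j ⌋ ∧ H h h′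
  adj-copy-copy i j h h′
    rewrite split-copy i h | split-copy j h′
          | quotient-combine i h | remainder-combine i h
          | quotient-combine j h′ | remainder-combine j h′ = refl

  base-base⁻ : ∀ {i j} → T (E (base i) (base j)) → T (G i j)
  base-base⁻ {i} {j} = subst T (adj-base-base i j)

  base-base⁺ : ∀ {i j} → T (G i j) → T (E (base i) (base j))
  base-base⁺ {i} {j} = subst T (sym (adj-base-base i j))

  base-copy⁻ : ∀ {i j h} → T (E (base i) (copy j h)) → i ≡ j
  base-copy⁻ {i} {j} {h} e = toWitness (subst T (adj-base-copy i j h) e)

  base-copy⁺ : ∀ i h → T (E (base i) (copy i h))
  base-copy⁺ i h = subst T (sym (adj-base-copy i i h)) (fromWitness refl)

  copy-base⁻ : ∀ {i j h} → T (E (copy j h) (base i)) → j ≡ i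
  copy-base⁻ {i} {j} {h} e = toWitness (subst T (adj-copy-base i j h) e)

  copy-base⁺ : ∀ i h → T (E (copy i h) (base i))
  copy-base⁺ i h = subst T (sym (adj-copy-base i i h)) (fromWitness refl)

  copy-copy⁻ : ∀ {i j h h′} → T (E (copy i h) (copy j h′)) → i ≡ j × T (H h h′)
  copy-copy⁻ {i} {j} {h} {h′} e with Equivalence.to T-∧ (subst T (adj-copy-copy i j h h′) e)
  ... | i≡j , hh′ = toWitness i≡j , hh′

  copy-copy⁺ : ∀ i {h h′} → T (H h h′) → T (E (copy i h) (copy i h′))
  copy-copy⁺ i {h} {h′} hh′ =
    subst T (sym (adj-copy-copy i i h h′)) (Equivalence.from T-∧ (fromWitness refl , hh′))

  base≢copy : ∀ i j h → base i ≢ copy j h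
  base≢copy i j h eq with trans (sym (split-base i)) (trans (cong (splitAt n) eq) (split-copy j h))
  ... | ()

  copy-injective : ∀ {i j h h′} → copy i h ≡ copy j h′ → i ≡ j × h ≡ h′
  copy-injective eq = combine-injective _ _ _ _ (↑ʳ-injective n _ _ eq)

  data Vertex : Fin (n + n * m) → Set where
    at-base : ∀ i → Vertex (base i)
    at-copy : ∀ i h → Vertex (copy i h)

  classify : ∀ u → Vertex u
  classify u with splitAt n u in eq
  ... | inj₁ i = subst Vertex (splitAt⁻¹-↑ˡ eq) (at-base i)
  ... | inj₂ p = subst Vertex (trans (cong (n ↑ʳ_) (combine-remQuot {n} m p)) (splitAt⁻¹-↑ʳ eq))
                   (at-copy (proj₁ (remQuot {n} m p)) (proj₂ (remQuot {n} m p)))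

  open Walks E
  open Walks H using () renaming (dist-exists to dist-existsᴴ)

  embed-G : ∀ {i j k} → Walk G i j k → Walk E (base i) (base j) k
  embed-G here       = here
  embed-G (step e w) = step (base-base⁺ e) (embed-G w)

  embed-H : ∀ i {h x k} → Walk H h x k → Walk E (copy i h) (copy i x) k
  embed-H i here       = here
  embed-H i (step e w) = step (copy-copy⁺ i e) (embed-H i w)

  OutsideCopy : Fin n → Fin (n + n * m) → Set
  OutsideCopy i z = ∀ h → z ≢ copy i h

  base-outside : ∀ i j → OutsideCopy i (base j)
  base-outside i j h = base≢copy j i h

  copy-outside : ∀ {i j} h → j ≢ i → OutsideCopy i (copy j h)
  copy-outside h j≢i h′ eq = j≢i (proj₁ (copy-injective eq))

  outside-neighbour-is-base : ∀ {i z h} → OutsideCopy i z → T (E z (copy i h)) → z ≡ base i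
  outside-neighbour-is-base {z = z} out e with classify z
  ... | at-base j = cong base (base-copy⁻ e)
  ... | at-copy j h′ with copy-copy⁻ e
  ...   | refl , _ = ⊥-elim (out h′ refl)

  base-strictlyCloser : ∀ {i z h} → OutsideCopy i z → StrictlyCloser z (base i) (copy i h)
  base-strictlyCloser out here = ⊥-elim (out _ refl)
  base-strictlyCloser {i} out (step {y = z′} e w) with classify z′
  ... | at-base j with base-strictlyCloser (base-outside i j) w
  ...   | c , c<b , wc = suc c , s≤s c<b , step e wc
  base-strictlyCloser {i} out (step e w) | at-copy j h with j Fin.≟ i
  ... | yes refl = 0 , s≤s z≤n , subst (λ v → Walk E _ v 0) (outside-neighbour-is-base out e) here
  ... | no j≢i with base-strictlyCloser (copy-outside h j≢i) w
  ...   | c , c<b , wc = suc c , s≤s c<b , step e wc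

  copy-noFarther : ∀ {i z x y} → OutsideCopy i z → NoFarther z (copy i x) (copy i y)
  copy-noFarther {i} {x = x} out wy with base-strictlyCloser out wy
  ... | c , c<b , wc = suc c , c<b , subst (Walk E _ _) (+-comm c 1) (wc ++ʷ step (base-copy⁺ i x) here)

  reach-copy : Connected G → ∀ w i x → ∃[ k ] Walk E w (copy i x) k
  reach-copy connG w i x with classify w
  ... | at-base j  with connG j i
  ...   | _ , wG = _ , embed-G wG ++ʷ step (base-copy⁺ i x) here
  reach-copy connG w i x | at-copy j h with connG j i
  ...   | _ , wG = _ , step (copy-base⁺ j h) (embed-G wG ++ʷ step (base-copy⁺ i x) here)

  outside-¬distinguishes : Connected G → ∀ {i w x y} → OutsideCopy i w
                         → ¬ Distinguishes E w (copy i x) (copy i y)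
  outside-¬distinguishes connG {i} {w} {x} out =
    equidistant⇒¬distinguishes (proj₂ (reach-copy connG w i x)) (copy-noFarther out) (copy-noFarther out)

  copy-dist : DiameterAtMost H 2 → ∀ i {h x a} → Dist H h x a → Dist E (copy i h) (copy i x) a
  copy-dist diam i {h} {x} {a} dH@(wH , a-min) = embed-H i wH , least
    where
      -- Walks of length at most 1 stay inside H_i; longer ones cannot beat the diameter bound.
      least : ∀ j → Walk E (copy i h) (copy i x) j → a ≤ j
      least zero          w = a-min 0 (subst (λ v → Walk H h v 0) (proj₂ (copy-injective (walk-length-0 w))) here)
      least (suc zero)    w = a-min 1 (step (proj₂ (copy-copy⁻ (walk-length-1 w))) here)
      least (suc (suc j)) _ = ≤-trans (diam h x a dH) (s≤s (s≤s z≤n))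

  copy-distinguishes : Connected H → DiameterAtMost H 2 → ∀ i {w x y}
                     → Distinguishes H w x y → Distinguishes E (copy i w) (copy i x) (copy i y)
  copy-distinguishes connH diam i {w} {x} {y} d a b da db a≡b
    with dist-existsᴴ (proj₂ (connH w x)) | dist-existsᴴ (proj₂ (connH w y))
  ... | a′ , da′ | b′ , db′ =
    d a′ b′ da′ db′ (trans (dist-unique (copy-dist diam i da′) da)
                    (trans a≡b (dist-unique db (copy-dist diam i db′))))

  restrict : Subset (n + n * m) → Fin n → Subset m
  restrict S i = tabulate (λ h → lookup S (copy i h))

  restrict-∈ : ∀ {S i h} → copy i h ∈ S → h ∈ restrict S i
  restrict-∈ {S} {i} {h} ∈S = lookup⇒[]= h (restrict S i) (trans (lookup∘tabulate _ h) ([]=⇒lookup ∈S))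

  restrict-generator : Connected G → Connected H → DiameterAtMost H 2 → ∀ {S}
                     → IsLocalMetricGenerator E S → ∀ i → IsLocalMetricGenerator H (restrict S i)
  restrict-generator connG connH diam gen i x y e with gen (copy i x) (copy i y) (copy-copy⁺ i e)
  ... | w , w∈S , d with classify w
  ...   | at-base j = ⊥-elim (outside-¬distinguishes connG (base-outside i j) d)
  ...   | at-copy j h with j Fin.≟ i
  ...     | no j≢i  = ⊥-elim (outside-¬distinguishes connG (copy-outside h j≢i) d)
  ...     | yes refl = h , restrict-∈ w∈S , λ a b da db → d a b (copy-dist diam i da) (copy-dist diam i db)

  generator-lower-bound : Connected G → Connected H → DiameterAtMost H 2 → ∀ {k}
    → (∀ S₀ → IsLocalMetricGenerator H S₀ → k ≤ ∣ S₀ ∣)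
    → ∀ S → IsLocalMetricGenerator E S → n * k ≤ ∣ S ∣
  generator-lower-bound connG connH diam {k} minimal S gen = begin
    n * k                                                  ≤⟨ count-blocks-≥ n (lookup S ∘ (n ↑ʳ_)) per-copy ⟩
    count (lookup S ∘ (n ↑ʳ_))                             ≤⟨ m≤n+m _ _ ⟩
    count (lookup S ∘ base) + count (lookup S ∘ (n ↑ʳ_))  ≡⟨ count-↑ n (lookup S) ⟨
    count (lookup S)                                       ≡⟨ ∣p∣≡count-lookup S ⟨
    ∣ S ∣                                                  ∎
    where
      open ≤-Reasoning
      per-copy : ∀ i → k ≤ count (lookup S ∘ copy i)
      per-copy i = subst (k ≤_) (∣tabulate∣≡count (lookup S ∘ copy i))
                         (minimal (restrict S i) (restrict-generator connG connH diam gen i))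

  private
    in-lift : Subset m → Fin (n + n * m) → Bool
    in-lift S₀ u = [ (λ _ → false) , (λ p → lookup S₀ (proj₂ (remQuot {n} m p))) ]′ (splitAt n u)

  lift : Subset m → Subset (n + n * m)
  lift S₀ = tabulate (in-lift S₀)

  lookup-lift-base : ∀ S₀ i → lookup (lift S₀) (base i) ≡ false
  lookup-lift-base S₀ i rewrite lookup∘tabulate (in-lift S₀) (base i) | split-base i = refl

  lookup-lift-copy : ∀ S₀ i h → lookup (lift S₀) (copy i h) ≡ lookup S₀ h
  lookup-lift-copy S₀ i h
    rewrite lookup∘tabulate (in-lift S₀) (copy i h) | split-copy i h
          | remainder-combine i h = refl

  lift-∈ : ∀ {S₀ h} i → h ∈ S₀ → copy i h ∈ lift S₀
  lift-∈ {S₀} {h} i h∈ = lookup⇒[]= (copy i h) (lift S₀) (trans (lookup-lift-copy S₀ i h) ([]=⇒lookup h∈))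

  ∣lift∣ : ∀ S₀ → ∣ lift S₀ ∣ ≡ n * ∣ S₀ ∣
  ∣lift∣ S₀ = begin
    ∣ lift S₀ ∣                         ≡⟨ ∣p∣≡count-lookup (lift S₀) ⟩
    count (lookup (lift S₀))            ≡⟨ count-↑ n _ ⟩
    count (lookup (lift S₀) ∘ base) + count (lookup (lift S₀) ∘ (n ↑ʳ_))
      ≡⟨ cong₂ _+_ (trans (count-cong (lookup-lift-base S₀)) (count-false n)) (count-blocks-≡ n _ per-copy) ⟩
    n * ∣ S₀ ∣                          ∎
    where
      open ≡-Reasoning
      per-copy : ∀ i → count (lookup (lift S₀) ∘ copy i) ≡ ∣ S₀ ∣
      per-copy i = begin
        count (lookup (lift S₀) ∘ copy i) ≡⟨ count-cong (lookup-lift-copy S₀ i) ⟩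
        count (lookup S₀)                 ≡⟨ ∣p∣≡count-lookup S₀ ⟨
        ∣ S₀ ∣                            ∎

  module _ (loopless : ∀ i → G i i ≡ false) (2≤n : 2 ≤ n)
           (connH : Connected H) (diam : DiameterAtMost H 2)
           {S₀ : Subset m} (gen₀ : IsLocalMetricGenerator H S₀) {h₀ : Fin m} (h₀∈S₀ : h₀ ∈ S₀) where

    base-edge-distinguished : ∀ {i j} h → T (G i j) → Distinguishes E (copy i h) (base i) (base j)
    base-edge-distinguished {i} {j} h e = strictlyCloser⇒distinguishes closer
      where
        closer : StrictlyCloser (copy i h) (base i) (base j)
        closer {zero}        w = ⊥-elim (base≢copy j i h (sym (walk-length-0 w)))
        closer {suc zero}    w with copy-base⁻ (walk-length-1 w)
        ... | refl with subst T (loopless i) e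
        ...   | ()
        closer {suc (suc b)} _ = 1 , s≤s (s≤s z≤n) , step (copy-base⁺ i h) here

    lift-generator : IsLocalMetricGenerator E (lift S₀)
    lift-generator u v e with classify u | classify v
    ... | at-base i | at-base j = copy i h₀ , lift-∈ i h₀∈S₀ , base-edge-distinguished h₀ (base-base⁻ e)
    ... | at-base i | at-copy _ h with base-copy⁻ e
    ...   | refl with other-than 2≤n i
    ...     | j , j≢i = copy j h₀ , lift-∈ j h₀∈S₀ ,
                        strictlyCloser⇒distinguishes (base-strictlyCloser (copy-outside h₀ j≢i))
    lift-generator u v e | at-copy _ h | at-base i with copy-base⁻ e
    ...   | refl with other-than 2≤n i
    ...     | j , j≢i = copy j h₀ , lift-∈ j h₀∈S₀ ,
                        distinguishes-sym (strictlyCloser⇒distinguishes (base-strictlyCloser (copy-outside h₀ j≢i)))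
    lift-generator u v e | at-copy i h | at-copy _ h′ with copy-copy⁻ e
    ... | refl , hh′ with gen₀ h h′ hh′
    ...   | w , w∈S₀ , d = copy i w , lift-∈ i w∈S₀ , copy-distinguishes connH diam i d

mainTheorem12 : ∀ {n m} (G : Adj n) (H : Adj m) (k : ℕ)
    → IsSimple G → IsSimple H
    → Connected G → 2 ≤ n
    → HasDiameter H 2
    → LocalMetricDim H k
    → LocalMetricDim (corona G H) (n * k)
mainTheorem12 {n} G H k (_ , loopless) _ connG 2≤n (connH , diam , _ , _ , step edge _ , _)
              ((S₀ , gen₀ , ∣S₀∣≡k) , minimal) =
  (lift S₀ , lift-generator loopless 2≤n connH diam gen₀ (proj₂ (generator-nonempty gen₀ edge)) ,
             trans (∣lift∣ S₀) (cong (n *_) ∣S₀∣≡k))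
  , generator-lower-bound connG connH diam minimal
  where
    open Corona G H
    open Walks H using (generator-nonempty)
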